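{- Let $n\ge1$, $N=2^n$, and let $1\le s\le N$ be an integer written as $s=\sum_{i=0}^{t}N/2^{k_i}$ with integers $1\le k_0<k_1<\cdots<k_t$ (the positions of the $1$'s in the $n$-bit binary representation of $s$, most significant position being $1$). Then $\mathbf{I}[\ell_n\langle s\rangle]=\sum_{i=0}^{t}(k_i-2i)\,2^{1-k_i}$.
   Context: $\mathrm{true}=-1$, $\mathrm{false}=+1$. For $x\in\{ -1,1\}^n$ let $\mathrm{val}(x)=\sum_{i=1}^n b_i2^{n-i}$ where $b_i=0$ if $x_i=\mathrm{true}$ and $b_i=1$ if $x_i=\mathrm{false}$ (lexicographic order with $\mathrm{true}$ before $\mathrm{false}$). For $0\le s\le N$ the lexicographic function $\ell_n\langle s\rangle:\{ -1,1\}^n\to\{ -1,1\}$ is $\mathrm{true}$ exactly on the $s$ inputs with $\mathrm{val}(x)<s$. For a Boolean function $f$ on $n$ variables, $\hat f(S)=\mathbf{E}_x[f(x)\prod_{i\in S}x_i]$ ($x$ uniform) and the total influence is $\mathbf{I}[f]=\sum_{S\subseteq[n]}\hat f(S)^2|S|$. -}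

module Defs where

open import Data.Bool using (Bool; true; false; if_then_else_)
open import Data.Nat as ℕ using (ℕ; zero; suc; _<ᵇ_)
open import Data.Integer as ℤ using (ℤ; +_)
open import Data.Rational using (ℚ; 0ℚ; 1ℚ; ½; -_; _+_; _*_; _-_)
open import Data.List using (List; []; _∷_; map; concatMap; foldr)
open import Data.Vec using (Vec; []; _∷_)

-- Convention: true = -1, false = +1.  An input x ∈ {-1,1}^n is a
-- Vec Bool n, with Bool true encoding the value true (= -1).
pm : Bool → ℚ
pm true  = - 1ℚ
pm false = 1ℚ

bit : Bool → ℕ
bit true  = 0
bit false = 1

val : ∀ {n} → Vec Bool n → ℕ
val {zero}  []       = 0
val {suc n} (x ∷ xs) = bit x ℕ.* (2 ℕ.^ n) ℕ.+ val xs

lexFun : (n s : ℕ) → Vec Bool n → Bool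
lexFun n s x = val x <ᵇ s

-- list of all 2^n points of {-1,1}^n (also used for subsets S ⊆ [n],
-- with S encoded by its indicator vector: true = i ∈ S)
cube : (n : ℕ) → List (Vec Bool n)
cube zero    = [] ∷ []
cube (suc n) = concatMap (λ v → (true ∷ v) ∷ (false ∷ v) ∷ []) (cube n)

sumℚ : List ℚ → ℚ
sumℚ = foldr _+_ 0ℚ

invPow2 : ℕ → ℚ
invPow2 zero    = 1ℚ
invPow2 (suc k) = ½ * invPow2 k

chi : ∀ {n} → Vec Bool n → Vec Bool n → ℚ
chi []           []       = 1ℚ
chi (true  ∷ S)  (x ∷ xs) = pm x * chi S xs
chi (false ∷ S)  (x ∷ xs) = chi S xs

card : ∀ {n} → Vec Bool n → ℕ
card []          = 0
card (true ∷ S)  = suc (card S)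
card (false ∷ S) = card S

fourier : (n : ℕ) → (Vec Bool n → Bool) → Vec Bool n → ℚ
fourier n f S = invPow2 n * sumℚ (map (λ x → pm (f x) * chi S x) (cube n))

totalInfluence : (n : ℕ) → (Vec Bool n → Bool) → ℚ
totalInfluence n f =
  sumℚ (map (λ S → fourier n f S * fourier n f S * (+ card S Data.Rational./ 1)) (cube n))

binSum : ℕ → List ℕ → ℕ
binSum n []       = 0
binSum n (k ∷ ks) = 2 ℕ.^ (n ℕ.∸ k) ℕ.+ binSum n ks

formulaFrom : ℕ → List ℕ → ℚ
formulaFrom i []       = 0ℚ
formulaFrom i (k ∷ ks) =
  ((+ k ℤ.- + (2 ℕ.* i)) Data.Rational./ 1) * (1ℚ + 1ℚ) * invPow2 k
    + formulaFrom (suc i) ks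

formula : List ℕ → ℚ
formula = formulaFrom 0

module Submission where

-- Splitting off the first coordinate, a function g on {-1,1}^(n+1) with
-- restrictions g₀ = g(true , ·) and g₁ = g(false , ·) satisfies
--   I[g] = ½ (I[g₀] + I[g₁]) + ¼ E[(g₁ - g₀)²],
-- by the recursion of its Fourier coefficients and Parseval's identity.
-- For g = ℓ_(n+1)⟨s⟩ one restriction is constant and the other is again
-- lexicographic: if s ≤ 2^n then g₁ is constantly false and g₀ = ℓ_n⟨s⟩, and
-- if s = 2^n + t then g₀ is constantly true and g₁ = ℓ_n⟨t⟩.  Then (g₁ - g₀)²
-- is 4 times the indicator of ℓ_n⟨s⟩, resp. of ¬ ℓ_n⟨t⟩, whose mean is s/2^n,
-- resp. 1 - t/2^n.  Hence
--   I[ℓ_(n+1)⟨s⟩] = ½ I[ℓ_n⟨s⟩] + s/2^n   and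
--   I[ℓ_(n+1)⟨2^n + t⟩] = ½ I[ℓ_n⟨t⟩] + 1 - t/2^n,
-- and the closed formula satisfies the same recursions along the binary
-- digits of s.

open import Defs
open import Data.Bool using (Bool; true; false)
open import Data.Bool.Properties using (T-≡)
import Data.Integer as ℤ
open import Data.Integer using (+_)
import Data.Integer.Properties as ℤₚ
open import Data.List using (List; []; _∷_; map; concatMap)
open import Data.List.Relation.Unary.All as All using (All; []; _∷_)
open import Data.List.Relation.Unary.AllPairs using (_∷_)
open import Data.List.Relation.Unary.Linked as Linked using (Linked; []; [-]; _∷_)
open import Data.List.Relation.Unary.Linked.Properties using (Linked⇒All; Linked⇒AllPairs)
import Data.Nat as ℕ
open import Data.Nat using (ℕ; zero; suc; _≤_; _<_; _^_; _<ᵇ_; z≤n; s≤s)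
import Data.Nat.Properties as ℕₚ
open import Data.Product using (_×_; _,_; proj₂; ∃-syntax)
open import Data.Rational using (ℚ; 0ℚ; 1ℚ; ½; _+_; _*_; _-_; -_; _/_; toℚᵘ; fromℚᵘ)
open import Data.Rational.Properties
  using (+-assoc; +-identityʳ; toℚᵘ-injective; toℚᵘ-fromℚᵘ; toℚᵘ-homo-+)
import Data.Rational.Unnormalised as ℚᵘ
import Data.Rational.Unnormalised.Properties as ℚᵘₚ
open import Data.Rational.Solver using (module +-*-Solver)
open import Data.Vec using (Vec; []; _∷_)
open import Function.Bundles using (Equivalence)
open import Relation.Binary.PropositionalEquality
  using (_≡_; refl; sym; trans; cong; cong₂; subst; module ≡-Reasoning)

open +-*-Solver

infix 8 _²

_² : ℚ → ℚ
q ² = q * q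

4ℚ : ℚ
4ℚ = + 4 / 1

ℕ→ℚ : ℕ → ℚ
ℕ→ℚ m = + m / 1

/1-homo-+ : ∀ i j → (i ℤ.+ j) / 1 ≡ i / 1 + j / 1
/1-homo-+ i j = toℚᵘ-injective (begin
  toℚᵘ (fromℚᵘ (ℚᵘ.mkℚᵘ (i ℤ.+ j) 0)) ≈⟨ toℚᵘ-fromℚᵘ (ℚᵘ.mkℚᵘ (i ℤ.+ j) 0) ⟩
  ℚᵘ.mkℚᵘ (i ℤ.+ j) 0                 ≈⟨ ℚᵘ.*≡* numerators ⟩
  ℚᵘ.mkℚᵘ i 0 ℚᵘ.+ ℚᵘ.mkℚᵘ j 0        ≈⟨ ℚᵘₚ.+-cong (ℚᵘₚ.≃-sym (toℚᵘ-fromℚᵘ (ℚᵘ.mkℚᵘ i 0)))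
                                                    (ℚᵘₚ.≃-sym (toℚᵘ-fromℚᵘ (ℚᵘ.mkℚᵘ j 0))) ⟩
  toℚᵘ (i / 1) ℚᵘ.+ toℚᵘ (j / 1)      ≈⟨ ℚᵘₚ.≃-sym (toℚᵘ-homo-+ (i / 1) (j / 1)) ⟩
  toℚᵘ (i / 1 + j / 1)                ∎)
  where
  open ℚᵘₚ.≃-Reasoning
  numerators : (i ℤ.+ j) ℤ.* + 1 ≡ (i ℤ.* + 1 ℤ.+ j ℤ.* + 1) ℤ.* + 1
  numerators = cong (ℤ._* + 1) (sym (cong₂ ℤ._+_ (ℤₚ.*-identityʳ i) (ℤₚ.*-identityʳ j)))

ℕ→ℚ-+ : ∀ m n → ℕ→ℚ (m ℕ.+ n) ≡ ℕ→ℚ m + ℕ→ℚ n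
ℕ→ℚ-+ m n = /1-homo-+ (+ m) (+ n)

/1-neg : ∀ m → (ℤ.- + m) / 1 ≡ - ℕ→ℚ m
/1-neg zero    = refl
/1-neg (suc m) = refl

/1-homo-sub : ∀ k m → (+ k ℤ.- + m) / 1 ≡ ℕ→ℚ k - ℕ→ℚ m
/1-homo-sub k m = trans (/1-homo-+ (+ k) (ℤ.- + m)) (cong (λ q → ℕ→ℚ k + q) (/1-neg m))

module _ {A : Set} where

  sumℚ-map-cong : ∀ (xs : List A) {f g : A → ℚ} → (∀ x → f x ≡ g x) →
                  sumℚ (map f xs) ≡ sumℚ (map g xs)
  sumℚ-map-cong []       f≡g = refl
  sumℚ-map-cong (x ∷ xs) f≡g = cong₂ _+_ (f≡g x) (sumℚ-map-cong xs f≡g)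

  sumℚ-map-+ : ∀ (xs : List A) (f g : A → ℚ) →
               sumℚ (map (λ x → f x + g x) xs) ≡ sumℚ (map f xs) + sumℚ (map g xs)
  sumℚ-map-+ []       f g = refl
  sumℚ-map-+ (x ∷ xs) f g =
    trans (cong (λ r → f x + g x + r) (sumℚ-map-+ xs f g))
          (solve 4 (λ a b c d → (a :+ b) :+ (c :+ d) := (a :+ c) :+ (b :+ d))
                 refl (f x) (g x) (sumℚ (map f xs)) (sumℚ (map g xs)))

  sumℚ-map-*ˡ : ∀ (xs : List A) c (f : A → ℚ) →
                sumℚ (map (λ x → c * f x) xs) ≡ c * sumℚ (map f xs)
  sumℚ-map-*ˡ []       c f = solve 1 (λ c → con 0ℚ := c :* con 0ℚ) refl c
  sumℚ-map-*ˡ (x ∷ xs) c f =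
    trans (cong (λ r → c * f x + r) (sumℚ-map-*ˡ xs c f))
          (solve 3 (λ c a b → c :* a :+ c :* b := c :* (a :+ b)) refl c (f x) (sumℚ (map f xs)))

_↾_ : ∀ {n} {A : Set} → (Vec Bool (suc n) → A) → Bool → Vec Bool n → A
(g ↾ b) x = g (b ∷ x)

∑ : (n : ℕ) → (Vec Bool n → ℚ) → ℚ
∑ n h = sumℚ (map h (cube n))

𝔼 : (n : ℕ) → (Vec Bool n → ℚ) → ℚ
𝔼 n h = invPow2 n * ∑ n h

∑-∷ : ∀ n (h : Vec Bool (suc n) → ℚ) → ∑ (suc n) h ≡ ∑ n (λ x → (h ↾ true) x + (h ↾ false) x)
∑-∷ n h = go (cube n)
  where
  go : ∀ xs → sumℚ (map h (concatMap (λ x → (true ∷ x) ∷ (false ∷ x) ∷ []) xs))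
            ≡ sumℚ (map (λ x → (h ↾ true) x + (h ↾ false) x) xs)
  go []       = refl
  go (x ∷ xs) = trans (cong (λ r → h (true ∷ x) + (h (false ∷ x) + r)) (go xs))
                      (sym (+-assoc (h (true ∷ x)) (h (false ∷ x)) _))

𝔼-cong : ∀ n {f g : Vec Bool n → ℚ} → (∀ x → f x ≡ g x) → 𝔼 n f ≡ 𝔼 n g
𝔼-cong n f≡g = cong (invPow2 n *_) (sumℚ-map-cong (cube n) f≡g)

𝔼-+ : ∀ n (f g : Vec Bool n → ℚ) → 𝔼 n (λ x → f x + g x) ≡ 𝔼 n f + 𝔼 n g
𝔼-+ n f g = trans (cong (invPow2 n *_) (sumℚ-map-+ (cube n) f g))
                  (solve 3 (λ p a b → p :* (a :+ b) := p :* a :+ p :* b)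
                           refl (invPow2 n) (∑ n f) (∑ n g))

𝔼-*ˡ : ∀ n c (f : Vec Bool n → ℚ) → 𝔼 n (λ x → c * f x) ≡ c * 𝔼 n f
𝔼-*ˡ n c f = trans (cong (invPow2 n *_) (sumℚ-map-*ˡ (cube n) c f))
                   (solve 3 (λ p c a → p :* (c :* a) := c :* (p :* a)) refl (invPow2 n) c (∑ n f))

𝔼-∷ : ∀ n (h : Vec Bool (suc n) → ℚ) → 𝔼 (suc n) h ≡ ½ * (𝔼 n (h ↾ true) + 𝔼 n (h ↾ false))
𝔼-∷ n h = begin
  ½ * invPow2 n * ∑ (suc n) h
    ≡⟨ cong (½ * invPow2 n *_) (trans (∑-∷ n h) (sumℚ-map-+ (cube n) (h ↾ true) (h ↾ false))) ⟩
  ½ * invPow2 n * (∑ n (h ↾ true) + ∑ n (h ↾ false))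
    ≡⟨ solve 3 (λ p a b → con ½ :* p :* (a :+ b) := con ½ :* (p :* a :+ p :* b))
             refl (invPow2 n) (∑ n (h ↾ true)) (∑ n (h ↾ false)) ⟩
  ½ * (𝔼 n (h ↾ true) + 𝔼 n (h ↾ false)) ∎
  where open ≡-Reasoning

𝔼-const : ∀ n c → 𝔼 n (λ _ → c) ≡ c
𝔼-const zero    c = solve 1 (λ c → con 1ℚ :* (c :+ con 0ℚ) := c) refl c
𝔼-const (suc n) c = trans (𝔼-∷ n (λ _ → c))
  (trans (cong (λ e → ½ * (e + e)) (𝔼-const n c)) (solve 1 (λ c → con ½ :* (c :+ c) := c) refl c))

fourierCoeff : (n : ℕ) → (Vec Bool n → ℚ) → Vec Bool n → ℚ
fourierCoeff n g S = 𝔼 n (λ x → g x * chi S x)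

-- totalInfluence n f unfolds to influence n (λ x → pm (f x)).
influence : (n : ℕ) → (Vec Bool n → ℚ) → ℚ
influence n g = ∑ n (λ S → fourierCoeff n g S ² * ℕ→ℚ (card S))

fourierCoeff-cong : ∀ n {f g : Vec Bool n → ℚ} → (∀ x → f x ≡ g x) → ∀ S →
                    fourierCoeff n f S ≡ fourierCoeff n g S
fourierCoeff-cong n f≡g S = 𝔼-cong n (λ x → cong (_* chi S x) (f≡g x))

fourierCoeff-*ˡ : ∀ n c (f : Vec Bool n → ℚ) S →
                  𝔼 n (λ x → f x * (c * chi S x)) ≡ c * fourierCoeff n f S
fourierCoeff-*ˡ n c f S =
  trans (𝔼-cong n (λ x → solve 3 (λ c a b → a :* (c :* b) := c :* (a :* b)) refl c (f x) (chi S x)))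
        (𝔼-*ˡ n c (λ x → f x * chi S x))

fourierCoeff-sub : ∀ n (f g : Vec Bool n → ℚ) S →
                 fourierCoeff n (λ x → f x - g x) S ≡ fourierCoeff n f S - fourierCoeff n g S
fourierCoeff-sub n f g S = begin
  𝔼 n (λ x → (f x - g x) * chi S x)
    ≡⟨ 𝔼-cong n (λ x → solve 3 (λ a b c → (a :- b) :* c := a :* c :+ b :* (con (- 1ℚ) :* c))
                              refl (f x) (g x) (chi S x)) ⟩
  𝔼 n (λ x → f x * chi S x + g x * (- 1ℚ * chi S x))
    ≡⟨ 𝔼-+ n _ _ ⟩
  fourierCoeff n f S + 𝔼 n (λ x → g x * (- 1ℚ * chi S x))
    ≡⟨ cong (λ q → fourierCoeff n f S + q) (fourierCoeff-*ˡ n (- 1ℚ) g S) ⟩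
  fourierCoeff n f S + - 1ℚ * fourierCoeff n g S
    ≡⟨ solve 2 (λ a b → a :+ con (- 1ℚ) :* b := a :- b)
             refl (fourierCoeff n f S) (fourierCoeff n g S) ⟩
  fourierCoeff n f S - fourierCoeff n g S ∎
  where open ≡-Reasoning

module _ {n} (g : Vec Bool (suc n) → ℚ) (S : Vec Bool n) where

  fourierCoeff-true∷ : fourierCoeff (suc n) g (true ∷ S)
                       ≡ ½ * (fourierCoeff n (g ↾ false) S - fourierCoeff n (g ↾ true) S)
  fourierCoeff-true∷ = begin
    fourierCoeff (suc n) g (true ∷ S)
      ≡⟨ 𝔼-∷ n _ ⟩
    ½ * (𝔼 n (λ x → g (true ∷ x) * (- 1ℚ * chi S x)) + 𝔼 n (λ x → g (false ∷ x) * (1ℚ * chi S x)))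
      ≡⟨ cong₂ (λ a b → ½ * (a + b)) (fourierCoeff-*ˡ n (- 1ℚ) (g ↾ true) S)
                                     (fourierCoeff-*ˡ n 1ℚ (g ↾ false) S) ⟩
    ½ * (- 1ℚ * fourierCoeff n (g ↾ true) S + 1ℚ * fourierCoeff n (g ↾ false) S)
      ≡⟨ solve 2 (λ a b → con ½ :* (con (- 1ℚ) :* a :+ con 1ℚ :* b) := con ½ :* (b :- a))
               refl (fourierCoeff n (g ↾ true) S) (fourierCoeff n (g ↾ false) S) ⟩
    ½ * (fourierCoeff n (g ↾ false) S - fourierCoeff n (g ↾ true) S) ∎
    where open ≡-Reasoning

  fourierCoeff-false∷ : fourierCoeff (suc n) g (false ∷ S)
                        ≡ ½ * (fourierCoeff n (g ↾ true) S + fourierCoeff n (g ↾ false) S)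
  fourierCoeff-false∷ = 𝔼-∷ n _

parseval : ∀ n (g : Vec Bool n → ℚ) →
           ∑ n (λ S → fourierCoeff n g S ²) ≡ 𝔼 n (λ x → g x ²)
parseval zero g =
  solve 1 (λ a → con 1ℚ :* (a :* con 1ℚ :+ con 0ℚ) :* (con 1ℚ :* (a :* con 1ℚ :+ con 0ℚ)) :+ con 0ℚ
               := con 1ℚ :* (a :* a :+ con 0ℚ))
          refl (g [])
parseval (suc n) g = begin
  ∑ (suc n) (λ S → ĝ S ²)
    ≡⟨ ∑-∷ n _ ⟩
  ∑ n (λ S → ĝ (true ∷ S) ² + ĝ (false ∷ S) ²)
    ≡⟨ sumℚ-map-cong (cube n) restricted-squares ⟩
  ∑ n (λ S → ½ * (a S ² + b S ²))
    ≡⟨ trans (sumℚ-map-*ˡ (cube n) ½ _) (cong (½ *_) (sumℚ-map-+ (cube n) _ _)) ⟩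
  ½ * (∑ n (λ S → a S ²) + ∑ n (λ S → b S ²))
    ≡⟨ cong₂ (λ p q → ½ * (p + q)) (parseval n (g ↾ true)) (parseval n (g ↾ false)) ⟩
  ½ * (𝔼 n (λ x → g (true ∷ x) ²) + 𝔼 n (λ x → g (false ∷ x) ²))
    ≡⟨ 𝔼-∷ n (λ x → g x ²) ⟨
  𝔼 (suc n) (λ x → g x ²) ∎
  where
  open ≡-Reasoning
  ĝ : Vec Bool (suc n) → ℚ
  ĝ = fourierCoeff (suc n) g
  a b : Vec Bool n → ℚ
  a = fourierCoeff n (g ↾ true)
  b = fourierCoeff n (g ↾ false)
  restricted-squares : ∀ S → ĝ (true ∷ S) ² + ĝ (false ∷ S) ²
                             ≡ ½ * (a S ² + b S ²)
  restricted-squares S =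
    trans (cong₂ (λ x y → x ² + y ²) (fourierCoeff-true∷ g S) (fourierCoeff-false∷ g S))
          (solve 2 (λ a b → con ½ :* (b :- a) :* (con ½ :* (b :- a))
                            :+ con ½ :* (a :+ b) :* (con ½ :* (a :+ b))
                         := con ½ :* (a :* a :+ b :* b))
                   refl (a S) (b S))

influence-∷ : ∀ n (g : Vec Bool (suc n) → ℚ) →
  influence (suc n) g ≡ ½ * (influence n (g ↾ true) + influence n (g ↾ false))
                        + ½ * ½ * 𝔼 n (λ x → (g (false ∷ x) - g (true ∷ x)) ²)
influence-∷ n g = begin
  influence (suc n) g
    ≡⟨ ∑-∷ n _ ⟩
  ∑ n (λ S → ĝ (true ∷ S) ² * ℕ→ℚ (suc (card S)) + ĝ (false ∷ S) ² * ℕ→ℚ (card S))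
    ≡⟨ sumℚ-map-cong (cube n) restricted-terms ⟩
  ∑ n (λ S → ½ * (A S + B S) + ½ * ½ * (d̂ S ²))
    ≡⟨ sumℚ-map-+ (cube n) _ _ ⟩
  ∑ n (λ S → ½ * (A S + B S)) + ∑ n (λ S → ½ * ½ * (d̂ S ²))
    ≡⟨ cong₂ _+_ (trans (sumℚ-map-*ˡ (cube n) ½ _) (cong (½ *_) (sumℚ-map-+ (cube n) A B)))
                 (trans (sumℚ-map-*ˡ (cube n) (½ * ½) _) (cong (½ * ½ *_) (parseval n d))) ⟩
  ½ * (influence n (g ↾ true) + influence n (g ↾ false)) + ½ * ½ * 𝔼 n (λ x → d x ²) ∎
  where
  open ≡-Reasoning
  ĝ : Vec Bool (suc n) → ℚ
  ĝ = fourierCoeff (suc n) g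
  d : Vec Bool n → ℚ
  d x = g (false ∷ x) - g (true ∷ x)
  a b d̂ A B : Vec Bool n → ℚ
  a = fourierCoeff n (g ↾ true)
  b = fourierCoeff n (g ↾ false)
  d̂ = fourierCoeff n d
  A S = a S ² * ℕ→ℚ (card S)
  B S = b S ² * ℕ→ℚ (card S)
  restricted-terms : ∀ S → ĝ (true ∷ S) ² * ℕ→ℚ (suc (card S)) + ĝ (false ∷ S) ² * ℕ→ℚ (card S)
                           ≡ ½ * (A S + B S) + ½ * ½ * (d̂ S ²)
  restricted-terms S =
    trans (squares-identity (a S) (b S) (ℕ→ℚ (card S))
                            (fourierCoeff-true∷ g S) (fourierCoeff-false∷ g S) (ℕ→ℚ-+ 1 (card S)))
          (cong (λ δ → ½ * (A S + B S) + ½ * ½ * δ ²)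
                (sym (fourierCoeff-sub n (g ↾ false) (g ↾ true) S)))
    where
    squares-identity : ∀ a b c {x y c′} → x ≡ ½ * (b - a) → y ≡ ½ * (a + b) → c′ ≡ 1ℚ + c →
                   x ² * c′ + y ² * c ≡ ½ * (a ² * c + b ² * c) + ½ * ½ * (b - a) ²
    squares-identity a b c refl refl refl =
      solve 3 (λ a b c → con ½ :* (b :- a) :* (con ½ :* (b :- a)) :* (con 1ℚ :+ c)
                         :+ con ½ :* (a :+ b) :* (con ½ :* (a :+ b)) :* c
                      := con ½ :* (a :* a :* c :+ b :* b :* c)
                         :+ con ½ :* con ½ :* ((b :- a) :* (b :- a)))
              refl a b c

influence-cong : ∀ n {f g : Vec Bool n → ℚ} → (∀ x → f x ≡ g x) → influence n f ≡ influence n g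
influence-cong n f≡g =
  sumℚ-map-cong (cube n) (λ S → cong (λ c → c ² * ℕ→ℚ (card S)) (fourierCoeff-cong n f≡g S))

influence-const : ∀ n {g : Vec Bool n → ℚ} c → (∀ x → g x ≡ c) → influence n g ≡ 0ℚ
influence-const zero    {g} c _   =
  solve 1 (λ a → a :* a :* con 0ℚ :+ con 0ℚ := con 0ℚ) refl (fourierCoeff zero g [])
influence-const (suc n) {g} c g≡c = begin
  influence (suc n) g
    ≡⟨ influence-∷ n g ⟩
  ½ * (influence n (g ↾ true) + influence n (g ↾ false))
    + ½ * ½ * 𝔼 n (λ x → (g (false ∷ x) - g (true ∷ x)) ²)
    ≡⟨ cong₂ (λ p q → ½ * p + ½ * ½ * q)
             (cong₂ _+_ (influence-const n c (λ x → g≡c (true ∷ x)))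
                        (influence-const n c (λ x → g≡c (false ∷ x))))
             (trans (𝔼-cong n difference≡0) (𝔼-const n 0ℚ)) ⟩
  ½ * (0ℚ + 0ℚ) + ½ * ½ * 0ℚ
    ≡⟨ solve 0 (con ½ :* (con 0ℚ :+ con 0ℚ) :+ con ½ :* con ½ :* con 0ℚ := con 0ℚ) refl ⟩
  0ℚ ∎
  where
  open ≡-Reasoning
  difference≡0 : ∀ x → (g (false ∷ x) - g (true ∷ x)) ² ≡ 0ℚ
  difference≡0 x = trans (cong₂ (λ p q → (p - q) ²) (g≡c (false ∷ x)) (g≡c (true ∷ x)))
                         (solve 1 (λ c → (c :- c) :* (c :- c) := con 0ℚ) refl c)

val-false∷ : ∀ {n} (x : Vec Bool n) → val (false ∷ x) ≡ 2 ^ n ℕ.+ val x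
val-false∷ {n} x = cong (ℕ._+ val x) (ℕₚ.*-identityˡ (2 ^ n))

val<2^n : ∀ {n} (x : Vec Bool n) → val x < 2 ^ n
val<2^n []                  = s≤s z≤n
val<2^n {suc n} (true ∷ x)  = ℕₚ.<-≤-trans (val<2^n x) (ℕₚ.m≤m+n (2 ^ n) (2 ^ n ℕ.+ 0))
val<2^n {suc n} (false ∷ x) = subst (_< 2 ^ suc n) (sym (val-false∷ x))
  (ℕₚ.+-monoʳ-< (2 ^ n) (ℕₚ.<-≤-trans (val<2^n x) (ℕₚ.m≤m+n (2 ^ n) 0)))

<ᵇ-true : ∀ {m n} → m < n → (m <ᵇ n) ≡ true
<ᵇ-true m<n = Equivalence.to T-≡ (ℕₚ.<⇒<ᵇ m<n)

<ᵇ-false : ∀ {m n} → n ≤ m → (m <ᵇ n) ≡ false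
<ᵇ-false {m}     {zero}  _         = refl
<ᵇ-false {suc m} {suc n} (s≤s n≤m) = <ᵇ-false n≤m

+-cancelˡ-<ᵇ : ∀ k m n → (k ℕ.+ m <ᵇ k ℕ.+ n) ≡ (m <ᵇ n)
+-cancelˡ-<ᵇ zero    m n = refl
+-cancelˡ-<ᵇ (suc k) m n = +-cancelˡ-<ᵇ k m n

module _ {n} (x : Vec Bool n) where

  lexFun-false∷ : ∀ {s} → s ≤ 2 ^ n → lexFun (suc n) s (false ∷ x) ≡ false
  lexFun-false∷ {s} s≤2^n =
    trans (cong (_<ᵇ s) (val-false∷ x)) (<ᵇ-false (ℕₚ.≤-trans s≤2^n (ℕₚ.m≤m+n (2 ^ n) (val x))))

  lexFun-+-true∷ : ∀ t → lexFun (suc n) (2 ^ n ℕ.+ t) (true ∷ x) ≡ true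
  lexFun-+-true∷ t = <ᵇ-true (ℕₚ.<-≤-trans (val<2^n x) (ℕₚ.m≤m+n (2 ^ n) t))

  lexFun-+-false∷ : ∀ t → lexFun (suc n) (2 ^ n ℕ.+ t) (false ∷ x) ≡ lexFun n t x
  lexFun-+-false∷ t = trans (cong (_<ᵇ 2 ^ n ℕ.+ t) (val-false∷ x)) (+-cancelˡ-<ᵇ (2 ^ n) (val x) t)

indicator : Bool → ℚ
indicator true  = 1ℚ
indicator false = 0ℚ

density : ℕ → ℕ → ℚ
density n s = 𝔼 n (λ x → indicator (lexFun n s x))

lexInfluence : ℕ → ℕ → ℚ
lexInfluence n s = influence n (λ x → pm (lexFun n s x))

density-low : ∀ n {s} → s ≤ 2 ^ n → density (suc n) s ≡ ½ * density n s
density-low n {s} s≤2^n = begin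
  density (suc n) s
    ≡⟨ 𝔼-∷ n _ ⟩
  ½ * (density n s + 𝔼 n (λ x → indicator (lexFun (suc n) s (false ∷ x))))
    ≡⟨ cong (λ e → ½ * (density n s + e))
            (trans (𝔼-cong n (λ x → cong indicator (lexFun-false∷ x s≤2^n))) (𝔼-const n 0ℚ)) ⟩
  ½ * (density n s + 0ℚ)
    ≡⟨ cong (½ *_) (+-identityʳ (density n s)) ⟩
  ½ * density n s ∎
  where open ≡-Reasoning

density-high : ∀ n t → density (suc n) (2 ^ n ℕ.+ t) ≡ ½ * (1ℚ + density n t)
density-high n t = trans (𝔼-∷ n _) (cong₂ (λ p q → ½ * (p + q))
  (trans (𝔼-cong n (λ x → cong indicator (lexFun-+-true∷ x t))) (𝔼-const n 1ℚ))
  (𝔼-cong n (λ x → cong indicator (lexFun-+-false∷ x t))))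

pm-false-distance : ∀ b → (pm false - pm b) ² ≡ 4ℚ * indicator b
pm-false-distance true  = refl
pm-false-distance false = refl

pm-true-distance : ∀ b → (pm b - pm true) ² ≡ 4ℚ + - (4ℚ) * indicator b
pm-true-distance true  = refl
pm-true-distance false = refl

lexInfluence-low : ∀ n {s} → s ≤ 2 ^ n → lexInfluence (suc n) s ≡ ½ * lexInfluence n s + density n s
lexInfluence-low n {s} s≤2^n = begin
  influence (suc n) ℓ
    ≡⟨ influence-∷ n ℓ ⟩
  ½ * (lexInfluence n s + influence n (ℓ ↾ false))
    + ½ * ½ * 𝔼 n (λ x → (ℓ (false ∷ x) - ℓ (true ∷ x)) ²)
    ≡⟨ cong₂ (λ p q → ½ * (lexInfluence n s + p) + ½ * ½ * q)
             (influence-const n 1ℚ (λ x → cong pm (lexFun-false∷ x s≤2^n)))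
             (trans (𝔼-cong n distance) (𝔼-*ˡ n (4ℚ) _)) ⟩
  ½ * (lexInfluence n s + 0ℚ) + ½ * ½ * (4ℚ * density n s)
    ≡⟨ solve 2 (λ i d → con ½ :* (i :+ con 0ℚ) :+ con ½ :* con ½ :* (con 4ℚ :* d)
                      := con ½ :* i :+ d)
             refl (lexInfluence n s) (density n s) ⟩
  ½ * lexInfluence n s + density n s ∎
  where
  open ≡-Reasoning
  ℓ : Vec Bool (suc n) → ℚ
  ℓ x = pm (lexFun (suc n) s x)
  distance : ∀ x → (ℓ (false ∷ x) - ℓ (true ∷ x)) ²
                   ≡ 4ℚ * indicator (lexFun n s x)
  distance x = trans (cong (λ b → (pm b - ℓ (true ∷ x)) ²) (lexFun-false∷ x s≤2^n))
                     (pm-false-distance (lexFun n s x))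

lexInfluence-high : ∀ n t →
  lexInfluence (suc n) (2 ^ n ℕ.+ t) ≡ ½ * lexInfluence n t + (1ℚ - density n t)
lexInfluence-high n t = begin
  influence (suc n) ℓ
    ≡⟨ influence-∷ n ℓ ⟩
  ½ * (influence n (ℓ ↾ true) + influence n (ℓ ↾ false))
    + ½ * ½ * 𝔼 n (λ x → (ℓ (false ∷ x) - ℓ (true ∷ x)) ²)
    ≡⟨ cong₂ (λ p q → ½ * p + ½ * ½ * q)
             (cong₂ _+_ (influence-const n (- 1ℚ) (λ x → cong pm (lexFun-+-true∷ x t)))
                        (influence-cong n (λ x → cong pm (lexFun-+-false∷ x t))))
             (trans (𝔼-cong n distance)
                    (trans (𝔼-+ n _ _) (cong₂ _+_ (𝔼-const n (4ℚ)) (𝔼-*ˡ n (- 4ℚ) _)))) ⟩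
  ½ * (0ℚ + lexInfluence n t) + ½ * ½ * (4ℚ + - (4ℚ) * density n t)
    ≡⟨ solve 2 (λ i d → con ½ :* (con 0ℚ :+ i) :+ con ½ :* con ½ :* (con 4ℚ :+ con (- 4ℚ) :* d)
                      := con ½ :* i :+ (con 1ℚ :- d))
             refl (lexInfluence n t) (density n t) ⟩
  ½ * lexInfluence n t + (1ℚ - density n t) ∎
  where
  open ≡-Reasoning
  ℓ : Vec Bool (suc n) → ℚ
  ℓ x = pm (lexFun (suc n) (2 ^ n ℕ.+ t) x)
  distance : ∀ x → (ℓ (false ∷ x) - ℓ (true ∷ x)) ²
                   ≡ 4ℚ + - (4ℚ) * indicator (lexFun n t x)
  distance x = trans (cong₂ (λ b c → (pm b - pm c) ²) (lexFun-+-false∷ x t) (lexFun-+-true∷ x t))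
                     (pm-true-distance (lexFun n t x))

-- ks lists, increasingly, the positions of the 1-bits of an n-bit number
-- (position 1 is the most significant); 0∷_ and 1∷_ prepend a leading bit.
data BitPositions : ℕ → List ℕ → Set where
  []   : ∀ {n} → BitPositions n []
  0∷_  : ∀ {n ks} → BitPositions n ks → BitPositions (suc n) (map suc ks)
  1∷_  : ∀ {n ks} → BitPositions n ks → BitPositions (suc n) (1 ∷ map suc ks)

unshift : ∀ {n ks} → Linked _<_ ks → All (λ k → 1 < k × k ≤ suc n) ks →
          ∃[ js ] ks ≡ map suc js × Linked _<_ js × All (λ j → 1 ≤ j × j ≤ n) js
unshift [] [] = [] , refl , [] , []
unshift [-] ((s≤s 1≤k , s≤s k≤n) ∷ []) = _ ∷ [] , refl , [-] , (1≤k , k≤n) ∷ []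
unshift (s≤s k<x ∷ l) ((s≤s 1≤k , s≤s k≤n) ∷ a) with unshift l a
... | _ ∷ js , refl , l′ , a′ = _ ∷ _ ∷ js , refl , k<x ∷ l′ , (1≤k , k≤n) ∷ a′

bitPositions : ∀ n {ks} → Linked _<_ ks → All (λ k → 1 ≤ k × k ≤ n) ks → BitPositions n ks
bitPositions n       []  [] = []
bitPositions zero    _   ((s≤s _ , ()) ∷ _)
bitPositions (suc n) {suc zero ∷ ks} l (_ ∷ a)
  with Linked⇒AllPairs ℕₚ.<-trans l
... | 1<ks ∷ _ with unshift (Linked.tail l) (All.zip (1<ks , All.map proj₂ a))
... | _ , refl , l′ , a′ = 1∷ bitPositions n l′ a′
bitPositions (suc n) {suc (suc k) ∷ ks} l a
  with unshift l (All.zip (Linked⇒All ℕₚ.<-trans (s≤s (s≤s z≤n)) l , All.map proj₂ a))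
... | _ ∷ _ , refl , l′ , a′ = 0∷ bitPositions n l′ a′

binSum-map-suc : ∀ n ks → binSum (suc n) (map suc ks) ≡ binSum n ks
binSum-map-suc n []       = refl
binSum-map-suc n (k ∷ ks) = cong (2 ^ (n ℕ.∸ k) ℕ.+_) (binSum-map-suc n ks)

binSum≤2^n : ∀ {n ks} → BitPositions n ks → binSum n ks ≤ 2 ^ n
binSum≤2^n [] = z≤n
binSum≤2^n (0∷_ {n} {ks} p) rewrite binSum-map-suc n ks =
  ℕₚ.≤-trans (binSum≤2^n p) (ℕₚ.m≤m+n (2 ^ n) (2 ^ n ℕ.+ 0))
binSum≤2^n (1∷_ {n} {ks} p) rewrite binSum-map-suc n ks =
  ℕₚ.+-monoʳ-≤ (2 ^ n) (ℕₚ.≤-trans (binSum≤2^n p) (ℕₚ.m≤m+n (2 ^ n) 0))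

dyadic : List ℕ → ℚ
dyadic ks = sumℚ (map invPow2 ks)

dyadic-map-suc : ∀ ks → dyadic (map suc ks) ≡ ½ * dyadic ks
dyadic-map-suc []       = solve 0 (con 0ℚ := con ½ :* con 0ℚ) refl
dyadic-map-suc (k ∷ ks) = trans (cong (λ d → ½ * invPow2 k + d) (dyadic-map-suc ks))
  (solve 2 (λ p d → con ½ :* p :+ con ½ :* d := con ½ :* (p :+ d)) refl (invPow2 k) (dyadic ks))

density-binSum : ∀ {n ks} → BitPositions n ks → density n (binSum n ks) ≡ dyadic ks
density-binSum {n} [] = 𝔼-const n 0ℚ
density-binSum (0∷_ {n} {ks} p) = begin
  density (suc n) (binSum (suc n) (map suc ks)) ≡⟨ cong (density (suc n)) (binSum-map-suc n ks) ⟩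
  density (suc n) (binSum n ks)                 ≡⟨ density-low n (binSum≤2^n p) ⟩
  ½ * density n (binSum n ks)                   ≡⟨ cong (½ *_) (density-binSum p) ⟩
  ½ * dyadic ks                                 ≡⟨ dyadic-map-suc ks ⟨
  dyadic (map suc ks)                           ∎
  where open ≡-Reasoning
density-binSum (1∷_ {n} {ks} p) = begin
  density (suc n) (2 ^ n ℕ.+ binSum (suc n) (map suc ks))
    ≡⟨ cong (λ t → density (suc n) (2 ^ n ℕ.+ t)) (binSum-map-suc n ks) ⟩
  density (suc n) (2 ^ n ℕ.+ binSum n ks)
    ≡⟨ density-high n (binSum n ks) ⟩
  ½ * (1ℚ + density n (binSum n ks))
    ≡⟨ cong (λ d → ½ * (1ℚ + d)) (density-binSum p) ⟩
  ½ * (1ℚ + dyadic ks)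
    ≡⟨ solve 1 (λ d → con ½ :* (con 1ℚ :+ d) := con ½ :* con 1ℚ :+ con ½ :* d) refl (dyadic ks) ⟩
  ½ * 1ℚ + ½ * dyadic ks
    ≡⟨ cong (λ d → ½ * 1ℚ + d) (dyadic-map-suc ks) ⟨
  dyadic (1 ∷ map suc ks) ∎
  where open ≡-Reasoning

term : ℕ → ℕ → ℚ
term i k = (ℕ→ℚ k - ℕ→ℚ (2 ℕ.* i)) * (1ℚ + 1ℚ) * invPow2 k

formulaFrom-∷ : ∀ i k ks → formulaFrom i (k ∷ ks) ≡ term i k + formulaFrom (suc i) ks
formulaFrom-∷ i k ks =
  cong (λ c → c * (1ℚ + 1ℚ) * invPow2 k + formulaFrom (suc i) ks) (/1-homo-sub k (2 ℕ.* i))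

term-suc : ∀ i k → term i (suc k) ≡ ½ * term i k + invPow2 k
term-suc i k = trans (cong (λ c → (c - m) * (1ℚ + 1ℚ) * (½ * invPow2 k)) (ℕ→ℚ-+ 1 k))
  (solve 3 (λ c m p → (con 1ℚ :+ c :- m) :* (con 1ℚ :+ con 1ℚ) :* (con ½ :* p)
                    := con ½ :* ((c :- m) :* (con 1ℚ :+ con 1ℚ) :* p) :+ p)
           refl (ℕ→ℚ k) m (invPow2 k))
  where
  m : ℚ
  m = ℕ→ℚ (2 ℕ.* i)

term-suc-index : ∀ i k → term i k ≡ term (suc i) k + 4ℚ * invPow2 k
term-suc-index i k = begin
  (c - m) * (1ℚ + 1ℚ) * p
    ≡⟨ solve 3 (λ c m p → (c :- m) :* (con 1ℚ :+ con 1ℚ) :* p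
                        := (c :- (con (1ℚ + 1ℚ) :+ m)) :* (con 1ℚ :+ con 1ℚ) :* p :+ con 4ℚ :* p)
             refl c m p ⟩
  (c - ((1ℚ + 1ℚ) + m)) * (1ℚ + 1ℚ) * p + 4ℚ * p
    ≡⟨ cong (λ m′ → (c - m′) * (1ℚ + 1ℚ) * p + 4ℚ * p)
            (trans (cong ℕ→ℚ (ℕₚ.*-suc 2 i)) (ℕ→ℚ-+ 2 (2 ℕ.* i))) ⟨
  (c - ℕ→ℚ (2 ℕ.* suc i)) * (1ℚ + 1ℚ) * p + 4ℚ * p ∎
  where
  open ≡-Reasoning
  c m p : ℚ
  c = ℕ→ℚ k
  m = ℕ→ℚ (2 ℕ.* i)
  p = invPow2 k

formulaFrom-map-suc : ∀ i ks → formulaFrom i (map suc ks) ≡ ½ * formulaFrom i ks + dyadic ks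
formulaFrom-map-suc i []       = solve 0 (con 0ℚ := con ½ :* con 0ℚ :+ con 0ℚ) refl
formulaFrom-map-suc i (k ∷ ks) = begin
  formulaFrom i (suc k ∷ map suc ks)
    ≡⟨ formulaFrom-∷ i (suc k) (map suc ks) ⟩
  term i (suc k) + formulaFrom (suc i) (map suc ks)
    ≡⟨ cong₂ _+_ (term-suc i k) (formulaFrom-map-suc (suc i) ks) ⟩
  (½ * term i k + invPow2 k) + (½ * formulaFrom (suc i) ks + dyadic ks)
    ≡⟨ solve 4 (λ t p f d → (con ½ :* t :+ p) :+ (con ½ :* f :+ d) := con ½ :* (t :+ f) :+ (p :+ d))
             refl (term i k) (invPow2 k) (formulaFrom (suc i) ks) (dyadic ks) ⟩
  ½ * (term i k + formulaFrom (suc i) ks) + (invPow2 k + dyadic ks)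
    ≡⟨ cong (λ f → ½ * f + dyadic (k ∷ ks)) (formulaFrom-∷ i k ks) ⟨
  ½ * formulaFrom i (k ∷ ks) + dyadic (k ∷ ks) ∎
  where open ≡-Reasoning

formulaFrom-suc : ∀ i ks → formulaFrom i ks ≡ formulaFrom (suc i) ks + 4ℚ * dyadic ks
formulaFrom-suc i []       = solve 0 (con 0ℚ := con 0ℚ :+ con 4ℚ :* con 0ℚ) refl
formulaFrom-suc i (k ∷ ks) = begin
  formulaFrom i (k ∷ ks)
    ≡⟨ formulaFrom-∷ i k ks ⟩
  term i k + formulaFrom (suc i) ks
    ≡⟨ cong₂ _+_ (term-suc-index i k) (formulaFrom-suc (suc i) ks) ⟩
  (term (suc i) k + 4ℚ * invPow2 k) + (formulaFrom (suc (suc i)) ks + 4ℚ * dyadic ks)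
    ≡⟨ solve 4 (λ t p f d → (t :+ con 4ℚ :* p) :+ (f :+ con 4ℚ :* d)
                          := (t :+ f) :+ con 4ℚ :* (p :+ d))
             refl (term (suc i) k) (invPow2 k) (formulaFrom (suc (suc i)) ks) (dyadic ks) ⟩
  (term (suc i) k + formulaFrom (suc (suc i)) ks) + 4ℚ * dyadic (k ∷ ks)
    ≡⟨ cong (λ f → f + 4ℚ * dyadic (k ∷ ks)) (formulaFrom-∷ (suc i) k ks) ⟨
  formulaFrom (suc i) (k ∷ ks) + 4ℚ * dyadic (k ∷ ks) ∎
  where open ≡-Reasoning

lexInfluence-binSum : ∀ {n ks} → BitPositions n ks → lexInfluence n (binSum n ks) ≡ formula ks
lexInfluence-binSum {n} [] = influence-const n 1ℚ (λ _ → refl)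
lexInfluence-binSum (0∷_ {n} {ks} p) = begin
  lexInfluence (suc n) (binSum (suc n) (map suc ks))
    ≡⟨ cong (lexInfluence (suc n)) (binSum-map-suc n ks) ⟩
  lexInfluence (suc n) (binSum n ks)
    ≡⟨ lexInfluence-low n (binSum≤2^n p) ⟩
  ½ * lexInfluence n (binSum n ks) + density n (binSum n ks)
    ≡⟨ cong₂ (λ f d → ½ * f + d) (lexInfluence-binSum p) (density-binSum p) ⟩
  ½ * formula ks + dyadic ks
    ≡⟨ formulaFrom-map-suc 0 ks ⟨
  formula (map suc ks) ∎
  where open ≡-Reasoning
lexInfluence-binSum (1∷_ {n} {ks} p) = begin
  lexInfluence (suc n) (2 ^ n ℕ.+ binSum (suc n) (map suc ks))
    ≡⟨ cong (λ t → lexInfluence (suc n) (2 ^ n ℕ.+ t)) (binSum-map-suc n ks) ⟩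
  lexInfluence (suc n) (2 ^ n ℕ.+ binSum n ks)
    ≡⟨ lexInfluence-high n (binSum n ks) ⟩
  ½ * lexInfluence n (binSum n ks) + (1ℚ - density n (binSum n ks))
    ≡⟨ cong₂ (λ f d → ½ * f + (1ℚ - d))
             (trans (lexInfluence-binSum p) (formulaFrom-suc 0 ks)) (density-binSum p) ⟩
  ½ * (formulaFrom 1 ks + 4ℚ * dyadic ks) + (1ℚ - dyadic ks)
    ≡⟨ solve 2 (λ f d → con ½ :* (f :+ con 4ℚ :* d) :+ (con 1ℚ :- d)
                      := con 1ℚ :+ (con ½ :* f :+ d))
             refl (formulaFrom 1 ks) (dyadic ks) ⟩
  1ℚ + (½ * formulaFrom 1 ks + dyadic ks)
    ≡⟨ cong (λ f → 1ℚ + f) (formulaFrom-map-suc 1 ks) ⟨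
  formula (1 ∷ map suc ks) ∎
  where open ≡-Reasoning

claim8 : (n : ℕ) → 1 ≤ n → (s : ℕ) → 1 ≤ s → s ≤ 2 ^ n →
    (ks : List ℕ) → Linked _<_ ks → All (λ k → 1 ≤ k × k ≤ n) ks →
    s ≡ binSum n ks →
    totalInfluence n (lexFun n s) ≡ formula ks
claim8 n _ _ _ _ ks sorted bounds refl = lexInfluence-binSum (bitPositions n sorted bounds)
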